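{- Let $B$ be a $k$-adjacency basis of a graph $G=(V,E)$ of order $n\ge 7$, and let $G'=(V,E')$ be a graph on the same vertex set with $N_{G'}(x)=N_G(x)$ for every $x\in B$. If $\operatorname{adim}_k(G)=k+2$, then $\operatorname{adim}_k(G')=k+2$.
   Context: All graphs are finite and simple; $N_G(x)$ is the open neighbourhood of $x$ in $G$. For a graph $G=(V,E)$, $d_{G,2}(x,y)=\min\{d_G(x,y),2\}$ with $d_G$ the shortest-path distance ($\infty$ between different components). For distinct $x,y$, $\mathcal{C}_G(x,y)=\{z\in V: d_{G,2}(x,z)\ne d_{G,2}(y,z)\}$. A set $S\subseteq V$ is a $k$-adjacency generator if $|S\cap\mathcal{C}_G(x,y)|\ge k$ for all distinct $x,y$; a minimum-cardinality one is a $k$-adjacency basis and its size is $\operatorname{adim}_k(G)$. -}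

module Defs where

open import Data.Nat using (ℕ; _≤_; _≡ᵇ_; _+_)
open import Data.Bool using (Bool; true; false; if_then_else_; not)
open import Data.Fin using (Fin; _≟_)
open import Data.Fin.Subset using (Subset; _∈_; _∩_; ∣_∣)
open import Data.Vec using (tabulate)
open import Data.Product using (∃; _×_)
open import Relation.Nullary using (¬_; does)
open import Relation.Binary.PropositionalEquality using (_≡_)

record Graph (n : ℕ) : Set where
  field
    adj    : Fin n → Fin n → Bool
    sym    : ∀ x y → adj x y ≡ adj y x
    irrefl : ∀ x → adj x x ≡ false
open Graph public

-- d_{G,2}(x,z) = min{d_G(x,z), 2}: 0 if x = z, 1 if adjacent, 2 otherwise.
d₂ : ∀ {n} → Graph n → Fin n → Fin n → ℕ
d₂ G x z = if does (x ≟ z) then 0 else (if adj G x z then 1 else 2)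

C : ∀ {n} → Graph n → Fin n → Fin n → Subset n
C G x y = tabulate (λ z → not (d₂ G x z ≡ᵇ d₂ G y z))

IsAdjGen : ∀ {n} → ℕ → Graph n → Subset n → Set
IsAdjGen k G S = ∀ x y → ¬ (x ≡ y) → k ≤ ∣ S ∩ C G x y ∣

IsAdjBasis : ∀ {n} → ℕ → Graph n → Subset n → Set
IsAdjBasis k G S = IsAdjGen k G S × (∀ S' → IsAdjGen k G S' → ∣ S ∣ ≤ ∣ S' ∣)

AdimIs : ∀ {n} → ℕ → Graph n → ℕ → Set
AdimIs k G m = ∃ λ S → IsAdjBasis k G S × ∣ S ∣ ≡ m

SameNbhd : ∀ {n} → Graph n → Graph n → Fin n → Set
SameNbhd G G' x = ∀ y → adj G' x y ≡ adj G x y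

-- Vertices of B see G and G' alike, and C G x y ∩ B only depends on adjacencies to B, so B stays a
-- k-adjacency generator of G'.  It is also minimum, because for k ≥ 1 and n ≥ 7 no graph has a
-- k-adjacency generator S with fewer than k + 2 vertices: S contains some a; by pigeonhole on
-- adjacency to a, two vertices x, y ∉ {a} are not distinguished by a, and the k ≥ 1 vertices of
-- S ∩ C G x y provide a second b ∈ S.  Pigeonhole on the four adjacency patterns to a and b then
-- gives x', y' ∉ {a, b} distinguished by neither, so k ≤ ∣ S ∩ C G x' y' ∣ ≤ ∣ S ∣ − 2.
-- For k = 0 the empty set is a generator, so adim₀ is never 2.
module Submission where

open import Defs
open import Data.Nat using (ℕ; _≤_; _+_)
open import Data.Fin.Subset using (Subset; _∈_; ∣_∣)
open import Relation.Binary.PropositionalEquality using (_≡_)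

open import Data.Bool using (Bool; false; T; not; if_then_else_)
open import Data.Bool.Properties using (not-injective)
open import Data.Empty using (⊥-elim)
open import Data.Fin using (Fin; zero; suc; _≟_; fromℕ; inject₁; combine)
import Data.Fin.Properties as Fin
open import Data.Fin.Subset using (_∉_; _∩_; _-_; _⊆_; Nonempty; inside; outside; ⊥)
open import Data.Fin.Subset.Properties
  using (x∈p∩q⁺; x∈p∩q⁻; x∈p∧x≢y⇒x∈p-y; x∈p⇒∣p-x∣<∣p∣; p⊆q⇒∣p∣≤∣q∣; ∣p∩q∣≤∣p∣; ∣⊥∣≡0)
open import Data.List using (List; []; _∷_; length)
open import Data.List.Relation.Unary.All using (All; []; _∷_)
open import Data.Nat using (zero; suc; _<_; _≡ᵇ_; z≤n; s≤s)
open import Data.Nat.Properties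
  using (≡⇒≡ᵇ; +-suc; +-comm; ≤-trans; ≤-antisym; n≤0⇒n≡0; 0≢1+n; module ≤-Reasoning)
open import Data.Product using (∃; ∃₂; _×_; _,_)
open import Data.Vec using ([]; _∷_; tabulate; here; there)
open import Data.Vec.Properties using ([]=⇒lookup; lookup∘tabulate)
open import Function using (_∘_; _↣_; Injection)
open import Function.Properties.Inverse using (↔⇒↣; ↔-sym)
open import Relation.Nullary using (does; yes; no)
open import Relation.Binary.PropositionalEquality using (_≢_; refl; trans; cong; cong₂; subst)
import Relation.Binary.PropositionalEquality as ≡

private
  variable
    n m k : ℕ
    x y : Fin n

-- The value a is made fresh, so a collision of tagged f a happens away from a.
tagged : (Fin n → Fin m) → Fin n → Fin n → Fin (suc m)
tagged f a x with x ≟ a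
... | yes _ = fromℕ _
... | no  _ = inject₁ (f x)

tagged-collision : ∀ (f : Fin n → Fin m) a → x ≢ y → tagged f a x ≡ tagged f a y →
                   x ≢ a × y ≢ a × f x ≡ f y
tagged-collision {x = x} {y} f a x≢y eq with x ≟ a | y ≟ a
... | yes x≡a | yes y≡a = ⊥-elim (x≢y (trans x≡a (≡.sym y≡a)))
... | yes _   | no  _   = ⊥-elim (Fin.fromℕ≢inject₁ eq)
... | no  _   | yes _   = ⊥-elim (Fin.fromℕ≢inject₁ (≡.sym eq))
... | no  x≢a | no  y≢a = x≢a , y≢a , Fin.inject₁-injective eq

pigeonhole-avoiding : ∀ (as : List (Fin n)) (f : Fin n → Fin m) → length as + m < n →
                      ∃₂ λ x y → x ≢ y × All (x ≢_) as × All (y ≢_) as × f x ≡ f y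
pigeonhole-avoiding [] f m<n with i , j , i<j , eq ← Fin.pigeonhole m<n f =
  i , j , Fin.<⇒≢ i<j , [] , [] , eq
pigeonhole-avoiding {n} {m} (a ∷ as) f lt
  with x , y , x≢y , x∉as , y∉as , eq ←
         pigeonhole-avoiding as (tagged f a) (subst (_< n) (≡.sym (+-suc (length as) m)) lt)
  with x≢a , y≢a , fx≡fy ← tagged-collision f a x≢y eq =
  x , y , x≢y , x≢a ∷ x∉as , y≢a ∷ y∉as , fx≡fy

bit : Bool ↣ Fin 2
bit = ↔⇒↣ (↔-sym Fin.2↔Bool)

open Injection bit using () renaming (to to bitOf; injective to bitOf-injective)

p∩q⊆p-x∩q : ∀ {p q : Subset n} {x} → x ∉ q → p ∩ q ⊆ (p - x) ∩ q
p∩q⊆p-x∩q {p = p} {q} x∉q z∈p∩q with z∈p , z∈q ← x∈p∩q⁻ p q z∈p∩q =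
  x∈p∩q⁺ (x∈p∧x≢y⇒x∈p-y z∈p (λ { refl → x∉q z∈q }) , z∈q)

∣p∣>0⇒Nonempty : ∀ {p : Subset n} → 0 < ∣ p ∣ → Nonempty p
∣p∣>0⇒Nonempty {p = inside  ∷ p} _     = zero , here
∣p∣>0⇒Nonempty {p = outside ∷ p} 0<∣p∣ with z , z∈p ← ∣p∣>0⇒Nonempty 0<∣p∣ = suc z , there z∈p

∩-tabulate-cong : ∀ (p : Subset n) {f g : Fin n → Bool} → (∀ z → z ∈ p → f z ≡ g z) →
                  p ∩ tabulate f ≡ p ∩ tabulate g
∩-tabulate-cong []            f≗g = refl
∩-tabulate-cong (inside  ∷ p) f≗g =
  cong₂ _∷_ (f≗g zero here) (∩-tabulate-cong p (λ z z∈p → f≗g (suc z) (there z∈p)))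
∩-tabulate-cong (outside ∷ p) f≗g =
  cong (outside ∷_) (∩-tabulate-cong p (λ z z∈p → f≗g (suc z) (there z∈p)))

d₂-≢ : (G : Graph n) → x ≢ y → d₂ G x y ≡ (if adj G x y then 1 else 2)
d₂-≢ {x = x} {y} G x≢y with x ≟ y
... | yes x≡y = ⊥-elim (x≢y x≡y)
... | no  _   = refl

d₂-sameNbhd : (G G' : Graph n) {z : Fin n} → SameNbhd G G' z → ∀ x → d₂ G x z ≡ d₂ G' x z
d₂-sameNbhd G G' {z} same x =
  cong (λ b → if does (x ≟ z) then 0 else (if b then 1 else 2))
       (trans (Graph.sym G x z) (trans (≡.sym (same x)) (Graph.sym G' z x)))

Undistinguished : Graph n → Fin n → Fin n → Fin n → Set
Undistinguished G x y z = x ≢ z × y ≢ z × adj G x z ≡ adj G y z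

Undistinguished⇒∉C : (G : Graph n) {z : Fin n} → Undistinguished G x y z → z ∉ C G x y
Undistinguished⇒∉C {x = x} {y} G {z} (x≢z , y≢z , sameAdj) z∈C =
  subst T (not-injective z-separates) (≡⇒≡ᵇ _ _ sameDistance)
  where
  z-separates : not (d₂ G x z ≡ᵇ d₂ G y z) ≡ not false
  z-separates = trans (≡.sym (lookup∘tabulate _ z)) ([]=⇒lookup z∈C)

  sameDistance : d₂ G x z ≡ d₂ G y z
  sameDistance = begin
    d₂ G x z                     ≡⟨ d₂-≢ G x≢z ⟩
    (if adj G x z then 1 else 2) ≡⟨ cong (λ b → if b then 1 else 2) sameAdj ⟩
    (if adj G y z then 1 else 2) ≡⟨ ≡.sym (d₂-≢ G y≢z) ⟩
    d₂ G y z                     ∎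
    where open ≡.≡-Reasoning

undistinguishedPair₁ : 3 < n → (G : Graph n) (a : Fin n) →
                       ∃₂ λ x y → x ≢ y × Undistinguished G x y a
undistinguishedPair₁ 3<n G a
  with x , y , x≢y , x≢a ∷ [] , y≢a ∷ [] , eq ←
         pigeonhole-avoiding (a ∷ []) (λ v → bitOf (adj G v a)) 3<n =
  x , y , x≢y , (x≢a , y≢a , bitOf-injective eq)

undistinguishedPair₂ : 6 < n → (G : Graph n) (a b : Fin n) →
                       ∃₂ λ x y → x ≢ y × Undistinguished G x y a × Undistinguished G x y b
undistinguishedPair₂ 6<n G a b
  with x , y , x≢y , x≢a ∷ x≢b ∷ [] , y≢a ∷ y≢b ∷ [] , eq ←
         pigeonhole-avoiding (a ∷ b ∷ []) (λ v → combine (bitOf (adj G v a)) (bitOf (adj G v b))) 6<n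
  with eqa , eqb ← Fin.combine-injective _ _ _ _ eq =
  x , y , x≢y , (x≢a , y≢a , bitOf-injective eqa) , (x≢b , y≢b , bitOf-injective eqb)

adjGen-meetsC : (G : Graph n) (S : Subset n) → 1 ≤ k → IsAdjGen k G S →
                ∀ x y → x ≢ y → ∃ λ z → z ∈ S × z ∈ C G x y
adjGen-meetsC G S 1≤k gen x y x≢y with z , z∈ ← ∣p∣>0⇒Nonempty (≤-trans 1≤k (gen x y x≢y)) =
  z , x∈p∩q⁻ S (C G x y) z∈

adjGen-lowerBound : 7 ≤ n → 1 ≤ k → (G : Graph n) (S : Subset n) → IsAdjGen k G S → k + 2 ≤ ∣ S ∣
adjGen-lowerBound {k = k} 7≤n@(s≤s (s≤s _)) 1≤k G S gen
  with a , a∈S , _ ← adjGen-meetsC G S 1≤k gen zero (suc zero) (λ ())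
  with x , y , x≢y , a-blind ← undistinguishedPair₁ (≤-trans (s≤s (s≤s (s≤s (s≤s z≤n)))) 7≤n) G a
  with b , b∈S , b∈C ← adjGen-meetsC G S 1≤k gen x y x≢y
  with x' , y' , x'≢y' , a-blind' , b-blind' ← undistinguishedPair₂ 7≤n G a b = begin
    k + 2                           ≡⟨ +-comm k 2 ⟩
    2 + k                           ≤⟨ s≤s (s≤s (gen x' y' x'≢y')) ⟩
    2 + ∣ S ∩ C G x' y' ∣           ≤⟨ s≤s (s≤s (p⊆q⇒∣p∣≤∣q∣ (remove (S - a) b-blind' ∘ remove S a-blind'))) ⟩
    2 + ∣ (S - a - b) ∩ C G x' y' ∣ ≤⟨ s≤s (s≤s (∣p∩q∣≤∣p∣ (S - a - b) (C G x' y'))) ⟩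
    2 + ∣ S - a - b ∣               ≤⟨ s≤s (x∈p⇒∣p-x∣<∣p∣ {p = S - a} b∈S-a) ⟩
    1 + ∣ S - a ∣                   ≤⟨ x∈p⇒∣p-x∣<∣p∣ {p = S} a∈S ⟩
    ∣ S ∣                           ∎
  where
  open ≤-Reasoning

  remove : ∀ (p : Subset _) {x y z} → Undistinguished G x y z → p ∩ C G x y ⊆ (p - z) ∩ C G x y
  remove _ blind = p∩q⊆p-x∩q (Undistinguished⇒∉C G blind)

  b∈S-a : b ∈ S - a
  b∈S-a with b∈S-a , _ ← x∈p∩q⁻ (S - a) (C G x y) (remove S a-blind (x∈p∩q⁺ (b∈S , b∈C))) = b∈S-a

adjGen-sameNbhd : (G G' : Graph n) (S : Subset n) → (∀ z → z ∈ S → SameNbhd G G' z) →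
                  IsAdjGen k G S → IsAdjGen k G' S
adjGen-sameNbhd {k = k} G G' S same gen x y x≢y =
  subst (λ T → k ≤ ∣ T ∣) (∩-tabulate-cong S sameDistinction) (gen x y x≢y)
  where
  sameDistinction : ∀ z → z ∈ S → not (d₂ G x z ≡ᵇ d₂ G y z) ≡ not (d₂ G' x z ≡ᵇ d₂ G' y z)
  sameDistinction z z∈S = cong₂ (λ d d' → not (d ≡ᵇ d'))
    (d₂-sameNbhd G G' (same z z∈S) x) (d₂-sameNbhd G G' (same z z∈S) y)

adjBasis-∣∣-unique : (G : Graph n) (S S' : Subset n) →
                     IsAdjBasis k G S → IsAdjBasis k G S' → ∣ S ∣ ≡ ∣ S' ∣
adjBasis-∣∣-unique G S S' (gen , min) (gen' , min') = ≤-antisym (min S' gen') (min' S gen)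

adjBasis₀-∣∣≡0 : (G : Graph n) (S : Subset n) → IsAdjBasis 0 G S → ∣ S ∣ ≡ 0
adjBasis₀-∣∣≡0 {n} G S (_ , min) = n≤0⇒n≡0 (subst (∣ S ∣ ≤_) (∣⊥∣≡0 n) (min ⊥ (λ _ _ _ → z≤n)))

theorem23 : (n k : ℕ) → 7 ≤ n → (G G' : Graph n) (B : Subset n) →
    IsAdjBasis k G B →
    (∀ x → x ∈ B → SameNbhd G G' x) →
    AdimIs k G (k + 2) →
    AdimIs k G' (k + 2)
theorem23 n zero 7≤n G G' B _ _ (S , basisS , ∣S∣≡2) =
  ⊥-elim (0≢1+n (trans (≡.sym (adjBasis₀-∣∣≡0 G S basisS)) ∣S∣≡2))
theorem23 n k@(suc _) 7≤n G G' B basisB@(genB , _) same (S , basisS , ∣S∣≡k+2) =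
  B , (adjGen-sameNbhd G G' B same genB , minimal) , ∣B∣≡k+2
  where
  ∣B∣≡k+2 : ∣ B ∣ ≡ k + 2
  ∣B∣≡k+2 = trans (adjBasis-∣∣-unique G B S basisB basisS) ∣S∣≡k+2

  minimal : ∀ S' → IsAdjGen k G' S' → ∣ B ∣ ≤ ∣ S' ∣
  minimal S' gen' = subst (_≤ ∣ S' ∣) (≡.sym ∣B∣≡k+2) (adjGen-lowerBound 7≤n (s≤s z≤n) G' S' gen')
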